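{- For all integers $r,s\ge1$, \[ p_{r,s}=C_{r+s-2}+\sum_{k=1}^{s-1}C_{k-1}\,p_{r,s-k}. \]
   Context: $C_n=\frac{1}{n+1}\binom{2n}{n}$ is the $n$-th Catalan number, and for $r,s\ge1$, $p_{r,s}=\sum_{k=1}^{s}C_{r+s-(k+1)}C_{k-1}$. -}

module Defs where

open import Data.Nat using (ℕ; zero; suc; _+_; _*_; _∸_; _/_)
open import Data.Nat.Combinatorics using (_C_)

-- n-th Catalan number C_n = (1/(n+1)) * binom(2n, n)  (exact division in ℕ)
catalan : ℕ → ℕ
catalan n = ((2 * n) C n) / suc n

sum1 : ℕ → (ℕ → ℕ) → ℕ
sum1 zero    f = 0
sum1 (suc s) f = sum1 s f + f (suc s)

-- p_{r,s} = Σ_{k=1}^{s} C_{r+s-(k+1)} C_{k-1}   (meaningful for r,s ≥ 1,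
-- where r+s-(k+1) ≥ 0 so truncated subtraction is exact)
p : ℕ → ℕ → ℕ
p r s = sum1 s (λ k → catalan (r + s ∸ (k + 1)) * catalan (k ∸ 1))

module Submission where

-- Write  (f ⋆ g)(n) = Σ_{i=0}^{n} f(i) g(n-i)  for the
-- convolution of sequences.  For r = m+1, s = t+1 the definition of p reads
-- p_{r,s} = (C ⋆ G)(t) with G(x) = C_{m+x}, so the claim is the identity
--   (C ⋆ G)(t) = G(t) + Σ_{k=1}^{t} C_{k-1} (C ⋆ G)(t-k),
-- which holds for every sequence G as soon as C_0 = 1 and C satisfies
-- Segner's recurrence C_{n+1} = (C ⋆ C)(n): peel off the i = 0 term and use
-- associativity of ⋆.
--
-- First the closed form
-- C_n = binom(2n,n)/(n+1) is tied to lattice paths: the ballot numbers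
-- satisfy the reflection formula ballot(u,h) = binom(2u+h,u) - binom(2u+h,u-1),
-- whence C_n = ballot(n,0).  Segner's recurrence for C then follows from the
-- first-return decomposition of ballot paths, and finally p is rewritten as
-- a convolution, which gives the theorem.

open import Defs
open import Data.Nat using (ℕ; zero; suc; _+_; _*_; _∸_; _/_; _≥_; _≤_; s≤s; z≤n)
open import Data.Nat.Properties
open import Data.Nat.Combinatorics
  using (_C_; nC1≡n; nCk≡nC[n∸k]; k>n⇒nCk≡0; nCk+nC[k+1]≡[n+1]C[k+1])
open import Data.Nat.DivMod using (m*n/n≡m)
open import Data.Nat.Solver using (module +-*-Solver)
open import Relation.Binary.PropositionalEquality
open +-*-Solver

-- binomBelow n k = binom(n, k-1), with binom(n, -1) = 0.  It lets Pascal's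
-- rule be stated uniformly for all k.
binomBelow : ℕ → ℕ → ℕ
binomBelow n zero    = 0
binomBelow n (suc k) = n C k

pascal : ∀ n k → suc n C k ≡ binomBelow n k + n C k
pascal n zero    = refl
pascal n (suc k) = sym (nCk+nC[k+1]≡[n+1]C[k+1] n k)

binom-sym : ∀ {n} k j → k + j ≡ n → n C k ≡ n C j
binom-sym k j refl =
  trans (nCk≡nC[n∸k] (m≤m+n k j)) (cong ((k + j) C_) (m+n∸m≡n k j))

absorption : ∀ n k → suc k * (suc n C suc k) ≡ suc n * (n C k)
absorption zero    zero    = refl
absorption zero    (suc k) =
  trans (cong (suc (suc k) *_) (k>n⇒nCk≡0 {1} {suc (suc k)} (s≤s (s≤s z≤n)))) (*-zeroʳ (suc (suc k)))
absorption (suc n) zero    =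
  trans (*-identityˡ _) (trans (nC1≡n (suc (suc n))) (sym (*-identityʳ (suc (suc n)))))
absorption (suc n) (suc k) = begin
  suc (suc k) * (suc (suc n) C suc (suc k))
    ≡⟨ cong (suc (suc k) *_) (pascal (suc n) (suc (suc k))) ⟩
  suc (suc k) * (a + b)
    ≡⟨ solve 3 (λ k a b → (con 2 :+ k) :* (a :+ b)
                         := a :+ ((con 1 :+ k) :* a :+ (con 2 :+ k) :* b)) refl k a b ⟩
  a + (suc k * a + suc (suc k) * b)
    ≡⟨ cong (a +_) (cong₂ _+_ (absorption n k) (absorption n (suc k))) ⟩
  a + (suc n * (n C k) + suc n * (n C suc k))
    ≡⟨ cong (a +_) (sym (*-distribˡ-+ (suc n) (n C k) (n C suc k))) ⟩
  a + suc n * (n C k + n C suc k)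
    ≡⟨ cong (λ x → a + suc n * x) (sym (pascal n (suc k))) ⟩
  suc (suc n) * a ∎
  where
  open ≡-Reasoning
  a b : ℕ
  a = suc n C suc k
  b = suc n C suc (suc k)

-- ballot u h counts the up/down lattice paths from height 0 that never go
-- below 0, have u down-steps and end at height h (classify by the last step).
ballot : ℕ → ℕ → ℕ
ballot zero    h       = 1
ballot (suc u) zero    = ballot u 1
ballot (suc u) (suc h) = ballot u (suc (suc h)) + ballot (suc u) h

-- Difference n u w : w is the difference binom(n,u) - binom(n,u-1), stated
-- additively since subtraction on ℕ truncates.
Difference : ℕ → ℕ → ℕ → Set
Difference n u w = w + binomBelow n u ≡ n C u

pascal-step : ∀ n u {w₁ w₂} →
  Difference n u w₁ → Difference n (suc u) w₂ → Difference (suc n) (suc u) (w₁ + w₂)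
pascal-step n u {w₁} {w₂} e₁ e₂ = begin
  (w₁ + w₂) + suc n C u
    ≡⟨ cong ((w₁ + w₂) +_) (pascal n u) ⟩
  (w₁ + w₂) + (binomBelow n u + n C u)
    ≡⟨ solve 4 (λ a b c d → (a :+ b) :+ (c :+ d) := (a :+ c) :+ (b :+ d))
               refl w₁ w₂ (binomBelow n u) (n C u) ⟩
  (w₁ + binomBelow n u) + (w₂ + n C u)
    ≡⟨ cong₂ _+_ e₁ e₂ ⟩
  n C u + n C suc u
    ≡⟨ nCk+nC[k+1]≡[n+1]C[k+1] n u ⟩
  suc n C suc u ∎
  where open ≡-Reasoning

next-row : ∀ u h → suc (u + (u + suc h)) ≡ suc u + (suc u + h)
next-row u h = cong (λ x → suc (u + x)) (+-suc u h)

-- The row index is written u + (u + h) so that for h = 0 it is 2 * u.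
-- Both recursive cases pass from row 2u+h+1 to row 2(u+1)+h by Pascal's rule;
-- at height 0 the second difference vanishes by symmetry of the odd row.
reflection : ∀ u h → Difference (u + (u + h)) u (ballot u h)
reflection zero    h       = refl
reflection (suc u) zero    =
  subst (λ n → Difference n (suc u) (ballot u 1)) (next-row u 0)
    (subst (Difference (suc (u + (u + 1))) (suc u)) (+-identityʳ (ballot u 1))
      (pascal-step (u + (u + 1)) u (reflection u 1)
        (binom-sym u (suc u) (cong (u +_) (sym (+-comm u 1))))))
reflection (suc u) (suc h) =
  subst (λ n → Difference n (suc u) (ballot (suc u) (suc h))) (next-row u (suc h))
    (pascal-step (u + (u + suc (suc h))) u (reflection u (suc (suc h)))
      (subst (λ n → Difference n (suc u) (ballot (suc u) h))
        (trans (sym (next-row u h))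
          (trans (sym (+-suc u (u + suc h))) (cong (u +_) (sym (+-suc u (suc h))))))
        (reflection (suc u) h)))

central-ratio : ∀ u → suc u * binomBelow (2 * u) u ≡ u * ((2 * u) C u)
central-ratio zero    = refl
central-ratio (suc v) = begin
  suc (suc v) * (suc K C v)         ≡⟨ cong (suc (suc v) *_) (binom-sym v (suc (suc v)) rowₑ) ⟩
  suc (suc v) * (suc K C suc (suc v)) ≡⟨ absorption K (suc v) ⟩
  suc K * (K C suc v)               ≡⟨ cong (suc K *_) (binom-sym (suc v) v rowₒ) ⟩
  suc K * (K C v)                   ≡⟨ sym (absorption K v) ⟩
  suc v * (suc K C suc v)           ∎
  where
  open ≡-Reasoning
  K : ℕ
  K = v + suc (v + 0)
  rowₑ : v + suc (suc v) ≡ suc K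
  rowₑ = solve 1 (λ v → v :+ (con 2 :+ v) := con 1 :+ (v :+ (con 1 :+ (v :+ con 0)))) refl v
  rowₒ : suc v + v ≡ K
  rowₒ = solve 1 (λ v → (con 1 :+ v) :+ v := v :+ (con 1 :+ (v :+ con 0))) refl v

ballot-central : ∀ u → suc u * ballot u 0 ≡ (2 * u) C u
ballot-central u = +-cancelʳ-≡ (u * b) _ _ (begin
  suc u * w + u * b           ≡⟨ cong (suc u * w +_) (sym (central-ratio u)) ⟩
  suc u * w + suc u * below   ≡⟨ sym (*-distribˡ-+ (suc u) w below) ⟩
  suc u * (w + below)         ≡⟨ cong (suc u *_) (reflection u 0) ⟩
  suc u * b                   ∎)
  where
  open ≡-Reasoning
  w b below : ℕ
  w     = ballot u 0
  b     = (2 * u) C u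
  below = binomBelow (2 * u) u

catalan-ballot : ∀ u → catalan u ≡ ballot u 0
catalan-ballot u = begin
  ((2 * u) C u) / suc u         ≡⟨ cong (_/ suc u) (sym (ballot-central u)) ⟩
  (suc u * ballot u 0) / suc u  ≡⟨ cong (_/ suc u) (*-comm (suc u) (ballot u 0)) ⟩
  (ballot u 0 * suc u) / suc u  ≡⟨ m*n/n≡m (ballot u 0) (suc u) ⟩
  ballot u 0                    ∎
  where
  open ≡-Reasoning

-- conv f g n = Σ_{i=0}^{n} f(i) g(n-i), computed by splitting off i = n.
conv : (ℕ → ℕ) → (ℕ → ℕ) → ℕ → ℕ
conv f g zero    = f 0 * g 0
conv f g (suc n) = conv f (λ j → g (suc j)) n + f (suc n) * g 0

conv-cong : ∀ {f f′ g g′} → (∀ i → f i ≡ f′ i) → (∀ i → g i ≡ g′ i) →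
  ∀ n → conv f g n ≡ conv f′ g′ n
conv-cong ef eg zero    = cong₂ _*_ (ef 0) (eg 0)
conv-cong ef eg (suc n) =
  cong₂ _+_ (conv-cong ef (λ i → eg (suc i)) n) (cong₂ _*_ (ef (suc n)) (eg 0))

conv-+ʳ : ∀ f g h n → conv f (λ j → g j + h j) n ≡ conv f g n + conv f h n
conv-+ʳ f g h zero    = *-distribˡ-+ (f 0) (g 0) (h 0)
conv-+ʳ f g h (suc n) = begin
  conv f (λ j → g (suc j) + h (suc j)) n + f (suc n) * (g 0 + h 0)
    ≡⟨ cong₂ _+_ (conv-+ʳ f (λ j → g (suc j)) (λ j → h (suc j)) n)
                 (*-distribˡ-+ (f (suc n)) (g 0) (h 0)) ⟩
  (conv f (λ j → g (suc j)) n + conv f (λ j → h (suc j)) n)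
    + (f (suc n) * g 0 + f (suc n) * h 0)
    ≡⟨ solve 4 (λ a b c d → (a :+ b) :+ (c :+ d) := (a :+ c) :+ (b :+ d)) refl
               (conv f (λ j → g (suc j)) n) (conv f (λ j → h (suc j)) n)
               (f (suc n) * g 0) (f (suc n) * h 0) ⟩
  conv f g (suc n) + conv f h (suc n) ∎
  where open ≡-Reasoning

conv-*ʳ : ∀ f g a n → conv f (λ j → g j * a) n ≡ conv f g n * a
conv-*ʳ f g a zero    = sym (*-assoc (f 0) (g 0) a)
conv-*ʳ f g a (suc n) =
  trans (cong₂ _+_ (conv-*ʳ f (λ j → g (suc j)) a n) (sym (*-assoc (f (suc n)) (g 0) a)))
        (sym (*-distribʳ-+ a (conv f (λ j → g (suc j)) n) (f (suc n) * g 0)))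

conv-assoc : ∀ f h g n → conv f (conv h g) n ≡ conv (conv f h) g n
conv-assoc f h g zero    = sym (*-assoc (f 0) (h 0) (g 0))
conv-assoc f h g (suc n) = begin
  conv f (λ j → conv h g′ j + h (suc j) * g 0) n + f (suc n) * (h 0 * g 0)
    ≡⟨ cong (_+ f (suc n) * (h 0 * g 0)) (conv-+ʳ f (conv h g′) (λ j → h (suc j) * g 0) n) ⟩
  (conv f (conv h g′) n + conv f (λ j → h (suc j) * g 0) n) + f (suc n) * (h 0 * g 0)
    ≡⟨ cong (λ x → x + f (suc n) * (h 0 * g 0))
            (cong₂ _+_ (conv-assoc f h g′ n) (conv-*ʳ f (λ j → h (suc j)) (g 0) n)) ⟩
  (conv (conv f h) g′ n + conv f h′ n * g 0) + f (suc n) * (h 0 * g 0)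
    ≡⟨ solve 5 (λ a b c d e → (a :+ b :* e) :+ c :* (d :* e) := a :+ (b :+ c :* d) :* e)
               refl (conv (conv f h) g′ n) (conv f h′ n) (f (suc n)) (h 0) (g 0) ⟩
  conv (conv f h) g (suc n) ∎
  where
  open ≡-Reasoning
  g′ h′ : ℕ → ℕ
  g′ = λ j → g (suc j)
  h′ = λ j → h (suc j)

conv-split-first : ∀ f g n → conv f g (suc n) ≡ f 0 * g (suc n) + conv (λ i → f (suc i)) g n
conv-split-first f g zero    = refl
conv-split-first f g (suc n) =
  trans (cong (_+ f (suc (suc n)) * g 0) (conv-split-first f (λ j → g (suc j)) n))
        (+-assoc (f 0 * g (suc (suc n))) (conv (λ i → f (suc i)) (λ j → g (suc j)) n)
                 (f (suc (suc n)) * g 0))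

sum1-cong : ∀ n {f g : ℕ → ℕ} → (∀ k → k ≤ n → f k ≡ g k) → sum1 n f ≡ sum1 n g
sum1-cong zero    e = refl
sum1-cong (suc n) e = cong₂ _+_ (sum1-cong n (λ k k≤n → e k (m≤n⇒m≤1+n k≤n))) (e (suc n) ≤-refl)

conv-sum1 : ∀ f g n → conv f g n ≡ sum1 (suc n) (λ k → f (k ∸ 1) * g (suc n ∸ k))
conv-sum1 f g zero    = refl
conv-sum1 f g (suc n) = cong₂ _+_
  (trans (conv-sum1 f (λ j → g (suc j)) n)
         (sum1-cong (suc n) (λ k k≤ → cong (λ x → f (k ∸ 1) * g x) (sym (+-∸-assoc 1 k≤)))))
  (cong (λ x → f (suc n) * g x) (sym (n∸n≡0 n)))

segner-conv-recurrence : ∀ f → f 0 ≡ 1 → (∀ n → f (suc n) ≡ conv f f n) →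
  ∀ g n → conv f g n ≡ g n + sum1 n (λ k → f (k ∸ 1) * conv f g (n ∸ k))
segner-conv-recurrence f f0≡1 segner g zero    = cong (_* g 0) f0≡1
segner-conv-recurrence f f0≡1 segner g (suc n) = begin
  conv f g (suc n)
    ≡⟨ conv-split-first f g n ⟩
  f 0 * g (suc n) + conv (λ i → f (suc i)) g n
    ≡⟨ cong₂ _+_ (trans (cong (_* g (suc n)) f0≡1) (*-identityˡ (g (suc n))))
                 (conv-cong segner (λ _ → refl) n) ⟩
  g (suc n) + conv (conv f f) g n
    ≡⟨ cong (g (suc n) +_) (sym (conv-assoc f f g n)) ⟩
  g (suc n) + conv f (conv f g) n
    ≡⟨ cong (g (suc n) +_) (conv-sum1 f (conv f g) n) ⟩
  g (suc n) + sum1 (suc n) (λ k → f (k ∸ 1) * conv f g (suc n ∸ k)) ∎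
  where open ≡-Reasoning

-- First-return decomposition: a path ending at height h+1 splits at its last
-- visit to height 0 into a path ending at 0 and a path ending at height h
-- (the latter shifted up one level).
ballot-first-return : ∀ u h →
  ballot u (suc h) ≡ conv (λ j → ballot j 0) (λ j → ballot j h) u
ballot-first-return zero    h       = refl
ballot-first-return (suc u) zero    =
  cong₂ _+_ (ballot-first-return u 1) (sym (*-identityʳ (ballot (suc u) 0)))
ballot-first-return (suc u) (suc h) = begin
  ballot u (suc (suc (suc h))) + ballot (suc u) (suc h)
    ≡⟨ cong₂ _+_ (ballot-first-return u (suc (suc h))) (ballot-first-return (suc u) h) ⟩
  conv c (λ j → ballot j (suc (suc h))) u + (conv c (λ j → ballot (suc j) h) u + c (suc u) * 1)
    ≡⟨ sym (+-assoc (conv c (λ j → ballot j (suc (suc h))) u) _ _) ⟩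
  conv c (λ j → ballot j (suc (suc h))) u + conv c (λ j → ballot (suc j) h) u + c (suc u) * 1
    ≡⟨ cong (_+ c (suc u) * 1)
            (sym (conv-+ʳ c (λ j → ballot j (suc (suc h))) (λ j → ballot (suc j) h) u)) ⟩
  conv c (λ j → ballot (suc j) (suc h)) u + c (suc u) * 1 ∎
  where
  open ≡-Reasoning
  c : ℕ → ℕ
  c = λ j → ballot j 0

catalan-segner : ∀ n → catalan (suc n) ≡ conv catalan catalan n
catalan-segner n =
  trans (catalan-ballot (suc n))
        (trans (ballot-first-return n 0) (sym (conv-cong catalan-ballot catalan-ballot n)))

p-conv : ∀ m t → p (suc m) (suc t) ≡ conv catalan (λ x → catalan (m + x)) t
p-conv m t = begin
  p (suc m) (suc t)
    ≡⟨ sum1-cong (suc t) (λ k k≤ →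
         trans (cong (λ x → catalan x * catalan (k ∸ 1)) (index k≤))
               (*-comm (catalan (m + (suc t ∸ k))) (catalan (k ∸ 1)))) ⟩
  sum1 (suc t) (λ k → catalan (k ∸ 1) * catalan (m + (suc t ∸ k)))
    ≡⟨ sym (conv-sum1 catalan (λ x → catalan (m + x)) t) ⟩
  conv catalan (λ x → catalan (m + x)) t ∎
  where
  open ≡-Reasoning
  index : ∀ {k} → k ≤ suc t → suc m + suc t ∸ (k + 1) ≡ m + (suc t ∸ k)
  index {k} k≤ = trans (cong (suc m + suc t ∸_) (+-comm k 1)) (+-∸-assoc m k≤)

lemma4p2 : (r s : ℕ) → r ≥ 1 → s ≥ 1 →
    p r s ≡ catalan (r + s ∸ 2) + sum1 (s ∸ 1) (λ k → catalan (k ∸ 1) * p r (s ∸ k))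
lemma4p2 zero    s       ()  _
lemma4p2 (suc m) zero    _   ()
lemma4p2 (suc m) (suc t) _   _ = begin
  p (suc m) (suc t)
    ≡⟨ p-conv m t ⟩
  conv catalan G t
    ≡⟨ segner-conv-recurrence catalan refl catalan-segner G t ⟩
  G t + sum1 t (λ k → catalan (k ∸ 1) * conv catalan G (t ∸ k))
    ≡⟨ cong₂ _+_ (cong (λ x → catalan (x ∸ 1)) (sym (+-suc m t)))
                 (sum1-cong t (λ k k≤t → cong (catalan (k ∸ 1) *_)
                   (trans (sym (p-conv m (t ∸ k))) (cong (p (suc m)) (sym (+-∸-assoc 1 k≤t)))))) ⟩
  catalan (suc m + suc t ∸ 2) + sum1 (suc t ∸ 1) (λ k → catalan (k ∸ 1) * p (suc m) (suc t ∸ k)) ∎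
  where
  open ≡-Reasoning
  G : ℕ → ℕ
  G = λ x → catalan (m + x)
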